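{- If $(P,\leq)$ is a poset which is not a chain and which satisfies the Descending Chain Condition, then there exists a monotone mapping from $P$ to $P$ which is not strictly upper cone preserving and hence not upper cone preserving.
   Context: For $A\subseteq P$, $U(A)=\{x\in P\mid a\leq x\text{ for all }a\in A\}$; write $U(x,y)=U(\{x,y\})$. A mapping $f\colon P\to P$ is monotone if $x\leq y$ implies $f(x)\leq f(y)$; upper cone preserving if $f(U(x,y))=U(f(x),f(y))$ for all $x,y\in P$; strictly upper cone preserving if this holds for all $x,y\in P$ with $x\neq y$. -}

module Defs where

open import Level using (Level; _⊔_)
open import Data.Nat using (ℕ; suc) renaming (_≤_ to _≤ℕ_)
open import Data.Product using (Σ; Σ-syntax; ∃; _×_)
open import Data.Sum using (_⊎_)
open import Relation.Nullary using (¬_)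
open import Relation.Unary using (Pred; _≐_)
open import Relation.Binary.Bundles using (Poset)

module _ {c ℓ₁ ℓ₂ : Level} (P : Poset c ℓ₁ ℓ₂) where
  open Poset P

  pair : Carrier → Carrier → Pred Carrier ℓ₁
  pair x y z = z ≈ x ⊎ z ≈ y

  U : ∀ {ℓ} → Pred Carrier ℓ → Pred Carrier (c ⊔ ℓ ⊔ ℓ₂)
  U A x = ∀ {a} → A a → a ≤ x

  U₂ : Carrier → Carrier → Pred Carrier (c ⊔ ℓ₁ ⊔ ℓ₂)
  U₂ x y = U (pair x y)

  image : ∀ {ℓ} → (Carrier → Carrier) → Pred Carrier ℓ → Pred Carrier (c ⊔ ℓ ⊔ ℓ₁)
  image f A z = Σ[ w ∈ Carrier ] (A w × f w ≈ z)

  Monotone : (Carrier → Carrier) → Set (c ⊔ ℓ₂)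
  Monotone f = ∀ {x y} → x ≤ y → f x ≤ f y

  UpperConePreserving : (Carrier → Carrier) → Set (c ⊔ ℓ₁ ⊔ ℓ₂)
  UpperConePreserving f = ∀ x y → image f (U₂ x y) ≐ U₂ (f x) (f y)

  StrictlyUpperConePreserving : (Carrier → Carrier) → Set (c ⊔ ℓ₁ ⊔ ℓ₂)
  StrictlyUpperConePreserving f =
    ∀ x y → ¬ (x ≈ y) → image f (U₂ x y) ≐ U₂ (f x) (f y)

  IsChain : Set (c ⊔ ℓ₂)
  IsChain = ∀ x y → x ≤ y ⊎ y ≤ x

  NotChain : Set (c ⊔ ℓ₂)
  NotChain = Σ[ a ∈ Carrier ] Σ[ b ∈ Carrier ] (¬ (a ≤ b) × ¬ (b ≤ a))

  DCC : Set (c ⊔ ℓ₁ ⊔ ℓ₂)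
  DCC = ∀ (s : ℕ → Carrier) → (∀ n → s (suc n) ≤ s n) →
        ∃ λ n → ∀ m → n ≤ℕ m → s m ≈ s n

{-# OPTIONS --safe #-}
module Submission where

-- A constant map x ↦ a already works, for any a having an incomparable
-- partner b. Preserving the
-- cone of a and b would force ↑a = U(a,a) to equal the image of U(a,b),
-- which is contained in {a}; so a = f w for an upper bound w of a and b,
-- and w ∈ ↑a must also be hit, giving w ≈ a and hence b ≤ a.

open import Defs
open import Level using (Level)
open import Function using (const)
open import Data.Product using (Σ-syntax; _×_; _,_)
open import Data.Sum using (inj₁; inj₂)
open import Relation.Nullary using (¬_)
open import Relation.Unary using (_≐_)
open import Relation.Binary.Bundles using (Poset)

module _ {c ℓ₁ ℓ₂ : Level} (P : Poset c ℓ₁ ℓ₂) where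
  open Poset P

  const-monotone : ∀ a → Monotone P (const a)
  const-monotone a _ = refl

  upperConePreserving⇒strictly : ∀ {f} →
    UpperConePreserving P f → StrictlyUpperConePreserving P f
  upperConePreserving⇒strictly preserves x y _ = preserves x y

  ≤⇒∈U₂-diag : ∀ {x z} → x ≤ z → U₂ P x x z
  ≤⇒∈U₂-diag x≤z (inj₁ a≈x) = trans (reflexive a≈x) x≤z
  ≤⇒∈U₂-diag x≤z (inj₂ a≈x) = trans (reflexive a≈x) x≤z

  const-preserves-U₂⇒≤ : ∀ a b →
    image P (const a) (U₂ P a b) ≐ U₂ P (const a a) (const a b) → b ≤ a
  const-preserves-U₂⇒≤ a b (_ , U₂⊆image)
    with U₂⊆image (≤⇒∈U₂-diag refl)
  ... | w , w-upper , _
    with U₂⊆image (≤⇒∈U₂-diag (w-upper (inj₁ Eq.refl)))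
  ... | _ , _ , a≈w = begin
    b ≤⟨ w-upper (inj₂ Eq.refl) ⟩
    w ≈⟨ Eq.sym a≈w ⟩
    a ∎
    where open import Relation.Binary.Reasoning.PartialOrder P

  const-not-strictlyUpperConePreserving : ∀ {a b} →
    ¬ (b ≤ a) → ¬ StrictlyUpperConePreserving P (const a)
  const-not-strictlyUpperConePreserving {a} {b} b≰a preserves =
    b≰a (const-preserves-U₂⇒≤ a b (preserves a b λ a≈b → b≰a (reflexive (Eq.sym a≈b))))

corollary4p6 : ∀ {c ℓ₁ ℓ₂ : Level} (P : Poset c ℓ₁ ℓ₂) →
    NotChain P → DCC P →
    Σ[ f ∈ (Poset.Carrier P → Poset.Carrier P) ]
      (Monotone P f × ¬ StrictlyUpperConePreserving P f × ¬ UpperConePreserving P f)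
corollary4p6 P (a , b , _ , b≰a) _ =
  const a , const-monotone P a , notStrictly ,
  λ preserves → notStrictly (upperConePreserving⇒strictly P preserves)
  where
  notStrictly : ¬ StrictlyUpperConePreserving P (const a)
  notStrictly = const-not-strictlyUpperConePreserving P b≰a
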